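{- Let $m\geqslant 2$, $k\geqslant 1$, and let $u,v\in\mathcal{A}_m^*$ have the same length. Then \[\binom{\sigma_m^k(u)}{0\,\overline{1}\cdots\overline{k}}-\binom{\sigma_m^k(v)}{0\,\overline{1}\cdots\overline{k}}=(|u|_0-|v|_0)\,m^{\binom{k}{2}}.\] In particular, if $u\not\sim_1 v$, then $\sigma_m^k(u)\not\sim_{k+1}\sigma_m^k(v)$.
   Context: $\mathcal{A}_m=\{0,\ldots,m-1\}=\mathbb{Z}/m\mathbb{Z}$; letters are reduced mod $m$ and $\overline{a}$ denotes the letter $-a\bmod m$, so $0\,\overline{1}\cdots\overline{k}$ is the length-$(k+1)$ word $0\,(-1)(-2)\cdots(-k)$ mod $m$. $\sigma_m$ is the morphism $\sigma_m(i)=i\,(i+1)\cdots(i+m-1)$. $|u|_a$ is the number of occurrences of letter $a$ in $u$. $\binom{u}{w}$ is the number of occurrences of $w$ as a (not necessarily contiguous) subword of $u$; $u\sim_k v$ iff $\binom{u}{z}=\binom{v}{z}$ for all words $z$ of length at most $k$ ($\sim_1$ is abelian equivalence). -}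

module Defs where

open import Data.Nat using (ℕ; zero; suc; _+_; _*_; _∸_; _^_; NonZero)
open import Data.Nat.DivMod using (_%_; m%n<n)
open import Data.Fin using (Fin; fromℕ<; toℕ)
open import Data.Fin.Properties using (_≟_)
open import Data.List using (List; []; _∷_; _++_; concatMap; map; upTo; length)
open import Data.Bool using (if_then_else_)
open import Relation.Nullary.Decidable using (⌊_⌋)

letter : (m : ℕ) → .{{NonZero m}} → ℕ → Fin m
letter m a = fromℕ< (m%n<n a m)

σ : (m : ℕ) → .{{NonZero m}} → Fin m → List (Fin m)
σ m i = map (λ j → letter m (toℕ i + j)) (upTo m)

σ* : (m : ℕ) → .{{NonZero m}} → List (Fin m) → List (Fin m)
σ* m = concatMap (σ m)

σ^ : (m : ℕ) → .{{NonZero m}} → ℕ → List (Fin m) → List (Fin m)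
σ^ m zero    u = u
σ^ m (suc k) u = σ* m (σ^ m k u)

-- the word 0 (-1) (-2) ... (-k) mod m  (length k+1); the letter at
-- position i is (m - i mod m) mod m, i.e. -i mod m
negLetter : (m : ℕ) → .{{NonZero m}} → ℕ → Fin m
negLetter m i = letter m (m ∸ (i % m))

patternWord : (m : ℕ) → .{{NonZero m}} → ℕ → List (Fin m)
patternWord m k = map (negLetter m) (upTo (suc k))

binom : {m : ℕ} → List (Fin m) → List (Fin m) → ℕ
binom u       []      = 1
binom []      (_ ∷ _) = 0
binom (a ∷ u) (b ∷ w) =
  (if ⌊ a ≟ b ⌋ then binom u w else 0) + binom u (b ∷ w)

count : {m : ℕ} → Fin m → List (Fin m) → ℕ
count a []      = 0
count a (b ∷ u) = (if ⌊ a ≟ b ⌋ then 1 else 0) + count a u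

_∼[_]_ : {m : ℕ} → List (Fin m) → ℕ → List (Fin m) → Set
_∼[_]_ {m} u k v = (z : List (Fin m)) → length z Data.Nat.≤ k → binom u z ≡ binom v z
  where open import Relation.Binary.PropositionalEquality using (_≡_)

{-# OPTIONS --safe #-}

-- Write Γₖ(x) = binom(σᵏ(x), Pₖ) for the pattern Pₖ = 0 (-1) ⋯ (-k), and compute binomial
-- coefficients of a concatenation as a convolution: binom(uv, w) = Σ_{w = pq} binom(u, p) binom(v, q).
--
-- By induction on k, all blocks σᵏ(x) are k-binomially equivalent and every letter occurs m^(k-1)
-- times in each of them, because σ(x+1) is a rotation of σ(x). So for |u| = |v| and |p| ≤ k+1 only
-- the occurrences of p inside a single block tell σᵏ(u) and σᵏ(v) apart:
--   binom(σᵏu, p) − binom(σᵏv, p) = Σ_{x∈u} binom(σᵏx, p) − Σ_{x∈v} binom(σᵏx, p),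
-- and the theorem reduces to Γₖ(x) = c + [x = 0]·m^(k choose 2).
--
-- For patterns of length k+2 the expansion picks up occurrences split over two blocks. Since
-- σᵏ(σ(x+1)) is σᵏ(σ(x)) with its first block moved to the end, and the tail of P_{k+1} is Pₖ shifted
-- by −1, these terms give Γ_{k+1}(x) − Γ_{k+1}(x+1) = m^k (Γₖ(x) − Γₖ(x+1)); directly,
-- Γ₁(x) − Γ₁(x+1) = [x = 0] − [x+1 = 0]. As x ↦ x+1 reaches every letter, Γₖ − [· = 0]·m^(k choose 2)
-- is constant. The second claim follows by translating the alphabet so that any letter plays the
-- role of 0.

module Submission where

open import Defs
open import Data.Bool using (true; false; if_then_else_)
open import Data.Empty using (⊥-elim)
open import Data.Fin using (Fin; toℕ)
open import Data.Fin.Properties using (_≟_; toℕ-fromℕ<; fromℕ<-cong; fromℕ<-toℕ; toℕ<n)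
open import Data.Integer using (ℤ; +_; _+_; _-_; _*_; 0ℤ; 1ℤ)
open import Data.Integer.Properties
  using (pos-+; pos-*; +-injective; +-inverseʳ; +-identityˡ; +-identityʳ; *-identityˡ; *-zeroʳ; *-distribʳ-+;
         i-j≡0⇒i≡j; i≡j⇒i-j≡0; i*j≡0⇒i≡0∨j≡0)
open import Data.Integer.Tactic.RingSolver using (solve-∀)
open import Data.List using (List; []; _∷_; _++_; _∷ʳ_; [_]; length; map; upTo; applyUpTo)
open import Data.List.Properties
  using (length-map; map-++; map-∘; map-cong; map-id; concatMap-++; ++-identityʳ;
         map-upTo; upTo-∷ʳ; map-applyUpTo; applyUpTo-∷ʳ; length-upTo)
open import Data.Nat as ℕ using (ℕ; zero; suc; pred; _≤_; _<_; z≤n; s≤s; NonZero; _^_; _∸_; _%_; _/_)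
open import Data.Nat.Combinatorics using (_C_; nC1≡n; nCk+nC[k+1]≡[n+1]C[k+1])
open import Data.Nat.DivMod using (m%n<n; m<n⇒m%n≡m; %-distribˡ-+; m%n%n≡m%n; [m+kn]%n≡m%n; m≡m%n+[m/n]*n)
open import Data.Nat.Properties as ℕₚ
  using (≤-refl; ≤-trans; m≤n⇒m≤1+n; n≤1+n; ≤-reflexive; suc-injective; suc-pred;
         +-comm; +-assoc; *-comm; *-assoc; m+[n∸m]≡n; m∸n+n≡m)
open import Data.Product using (_×_; _,_)
open import Data.Sum using ([_,_]′)
open import Function using (_∘_; id)
open import Function.Definitions using (Injective)
open import Relation.Binary.PropositionalEquality
  using (_≡_; _≢_; refl; sym; trans; cong; cong₂; subst₂; module ≡-Reasoning)
open import Relation.Nullary using (¬_; yes; no)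
open import Relation.Nullary.Decidable using (⌊_⌋)

open ≡-Reasoning

-- Convolution of functions on words

module _ {a} {A : Set a} where

  infixl 7 _⊛_

  -- (f ⊛ g) w is the sum of f p * g q over all factorisations w = p ++ q.
  _⊛_ : (List A → ℤ) → (List A → ℤ) → List A → ℤ
  (f ⊛ g) []      = f [] * g []
  (f ⊛ g) (c ∷ w) = f [] * g (c ∷ w) + ((f ∘ (c ∷_)) ⊛ g) w

  ⊛-cong : ∀ {f f′ g g′} w →
           (∀ p → length p ≤ length w → f p ≡ f′ p) →
           (∀ q → length q ≤ length w → g q ≡ g′ q) →
           (f ⊛ g) w ≡ (f′ ⊛ g′) w
  ⊛-cong []      f≈f′ g≈g′ = cong₂ _*_ (f≈f′ [] z≤n) (g≈g′ [] z≤n)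
  ⊛-cong (c ∷ w) f≈f′ g≈g′ = cong₂ _+_
    (cong₂ _*_ (f≈f′ [] z≤n) (g≈g′ (c ∷ w) ≤-refl))
    (⊛-cong w (λ p |p|≤ → f≈f′ (c ∷ p) (s≤s |p|≤)) (λ q |q|≤ → g≈g′ q (m≤n⇒m≤1+n |q|≤)))

  ⊛-zeroˡ : ∀ g w → ((λ _ → 0ℤ) ⊛ g) w ≡ 0ℤ
  ⊛-zeroˡ g []      = refl
  ⊛-zeroˡ g (c ∷ w) = trans (+-identityˡ _) (⊛-zeroˡ g w)

  ⊛-distribʳ-+ : ∀ f f′ g w → ((λ p → f p + f′ p) ⊛ g) w ≡ (f ⊛ g) w + (f′ ⊛ g) w
  ⊛-distribʳ-+ f f′ g []      = *-distribʳ-+ (g []) (f []) (f′ [])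
  ⊛-distribʳ-+ f f′ g (c ∷ w) = begin
    (f [] + f′ []) * g (c ∷ w) + ((λ p → f (c ∷ p) + f′ (c ∷ p)) ⊛ g) w
      ≡⟨ cong (λ z → (f [] + f′ []) * g (c ∷ w) + z) (⊛-distribʳ-+ (f ∘ (c ∷_)) (f′ ∘ (c ∷_)) g w) ⟩
    (f [] + f′ []) * g (c ∷ w) + (((f ∘ (c ∷_)) ⊛ g) w + ((f′ ∘ (c ∷_)) ⊛ g) w)
      ≡⟨ ring (f []) (f′ []) (g (c ∷ w)) _ _ ⟩
    (f ⊛ g) (c ∷ w) + (f′ ⊛ g) (c ∷ w) ∎
    where
    ring : ∀ a a′ b x x′ → (a + a′) * b + (x + x′) ≡ (a * b + x) + (a′ * b + x′)
    ring = solve-∀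

  ⊛-difference : ∀ f f′ g g′ w →
                 (f ⊛ g) w - (f′ ⊛ g′) w ≡ ((λ p → f p - f′ p) ⊛ g) w + (f′ ⊛ (λ q → g q - g′ q)) w
  ⊛-difference f f′ g g′ []      = ring (f []) (f′ []) (g []) (g′ [])
    where
    ring : ∀ a a′ b b′ → a * b - a′ * b′ ≡ (a - a′) * b + a′ * (b - b′)
    ring = solve-∀
  ⊛-difference f f′ g g′ (c ∷ w) = begin
    (f [] * g (c ∷ w) + ((f ∘ (c ∷_)) ⊛ g) w) - (f′ [] * g′ (c ∷ w) + ((f′ ∘ (c ∷_)) ⊛ g′) w)
      ≡⟨ ring₁ (f []) (f′ []) (g (c ∷ w)) (g′ (c ∷ w)) _ _ ⟩
    ((f [] - f′ []) * g (c ∷ w) + f′ [] * (g (c ∷ w) - g′ (c ∷ w)))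
      + (((f ∘ (c ∷_)) ⊛ g) w - ((f′ ∘ (c ∷_)) ⊛ g′) w)
      ≡⟨ cong (λ z → ((f [] - f′ []) * g (c ∷ w) + f′ [] * (g (c ∷ w) - g′ (c ∷ w))) + z)
              (⊛-difference (f ∘ (c ∷_)) (f′ ∘ (c ∷_)) g g′ w) ⟩
    ((f [] - f′ []) * g (c ∷ w) + f′ [] * (g (c ∷ w) - g′ (c ∷ w)))
      + (((λ p → f (c ∷ p) - f′ (c ∷ p)) ⊛ g) w + ((f′ ∘ (c ∷_)) ⊛ (λ q → g q - g′ q)) w)
      ≡⟨ ring₂ (f [] - f′ []) (f′ []) (g (c ∷ w)) (g (c ∷ w) - g′ (c ∷ w)) _ _ ⟩
    ((λ p → f p - f′ p) ⊛ g) (c ∷ w) + (f′ ⊛ (λ q → g q - g′ q)) (c ∷ w) ∎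
    where
    ring₁ : ∀ a a′ b b′ x x′ → (a * b + x) - (a′ * b′ + x′) ≡ ((a - a′) * b + a′ * (b - b′)) + (x - x′)
    ring₁ = solve-∀
    ring₂ : ∀ d a′ b e y y′ → (d * b + a′ * e) + (y + y′) ≡ (d * b + y) + (a′ * e + y′)
    ring₂ = solve-∀

  VanishesUpTo : ℕ → (List A → ℤ) → Set a
  VanishesUpTo n h = ∀ p → length p ≤ n → h p ≡ 0ℤ

  vanishes-∷ : ∀ {n h} c → VanishesUpTo (suc n) h → VanishesUpTo n (h ∘ (c ∷_))
  vanishes-∷ c h≈0 p |p|≤n = h≈0 (c ∷ p) (s≤s |p|≤n)

  ⊛-vanishes : ∀ {n h} f w → VanishesUpTo n h → length w ≤ n → (f ⊛ h) w ≡ 0ℤ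
  ⊛-vanishes f []      h≈0 _     = trans (cong (f [] *_) (h≈0 [] z≤n)) (*-zeroʳ (f []))
  ⊛-vanishes {h = h} f (c ∷ w) h≈0 |w|≤n = begin
    f [] * h (c ∷ w) + ((f ∘ (c ∷_)) ⊛ h) w
      ≡⟨ cong₂ (λ x y → f [] * x + y) (h≈0 (c ∷ w) |w|≤n)
               (⊛-vanishes (f ∘ (c ∷_)) w h≈0 (≤-trans (n≤1+n _) |w|≤n)) ⟩
    f [] * 0ℤ + 0ℤ
      ≡⟨ cong (_+ 0ℤ) (*-zeroʳ (f [])) ⟩
    0ℤ ∎

  ⊛-vanishingˡ : ∀ n {h} g w → VanishesUpTo n h → length w ≤ suc n → (h ⊛ g) w ≡ h w * g []
  ⊛-vanishingˡ n           g []          _   _          = refl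
  ⊛-vanishingˡ zero    {h} g (c ∷ [])    h≈0 _          =
    trans (cong (λ x → x * g [ c ] + h [ c ] * g []) (h≈0 [] z≤n)) (+-identityˡ _)
  ⊛-vanishingˡ zero        g (_ ∷ _ ∷ _) _   (s≤s ())
  ⊛-vanishingˡ (suc n) {h} g (c ∷ w)     h≈0 (s≤s |w|≤) =
    trans (cong₂ (λ x y → x * g (c ∷ w) + y) (h≈0 [] z≤n) (⊛-vanishingˡ n g w (vanishes-∷ c h≈0) |w|≤))
          (+-identityˡ _)

  ⊛-vanishingʳ : ∀ n {h} f w → VanishesUpTo n h → length w ≤ suc n → (f ⊛ h) w ≡ f [] * h w
  ⊛-vanishingʳ n     f []      _   _          = refl
  ⊛-vanishingʳ n {h} f (c ∷ w) h≈0 (s≤s |w|≤) =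
    trans (cong (λ x → f [] * h (c ∷ w) + x) (⊛-vanishes (f ∘ (c ∷_)) w h≈0 |w|≤)) (+-identityʳ _)

  ⊛-vanishingˡ-∷ʳ : ∀ n {h} g w d → VanishesUpTo n h → length w ≡ suc n →
                    (h ⊛ g) (w ∷ʳ d) ≡ h (w ∷ʳ d) * g [] + h w * g [ d ]
  ⊛-vanishingˡ-∷ʳ zero    {h} g (c ∷ []) d h≈0 _ =
    trans (cong (λ x → x * g (c ∷ d ∷ []) + (h [ c ] * g [ d ] + h (c ∷ d ∷ []) * g [])) (h≈0 [] z≤n))
          (ring (g (c ∷ d ∷ [])) (h [ c ] * g [ d ]) (h (c ∷ d ∷ []) * g []))
    where
    ring : ∀ x y z → 0ℤ * x + (y + z) ≡ z + y
    ring = solve-∀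
  ⊛-vanishingˡ-∷ʳ (suc n) {h} g (c ∷ w) d h≈0 |w|≡ =
    trans (cong₂ (λ x y → x * g (c ∷ w ∷ʳ d) + y) (h≈0 [] z≤n)
                 (⊛-vanishingˡ-∷ʳ n g w d (vanishes-∷ c h≈0) (suc-injective |w|≡)))
          (+-identityˡ _)

  ⊛-vanishingʳ-∷ : ∀ n {h} f c w → VanishesUpTo n h → length w ≡ suc n →
                   (f ⊛ h) (c ∷ w) ≡ f [] * h (c ∷ w) + f [ c ] * h w
  ⊛-vanishingʳ-∷ n {h} f c w h≈0 |w|≡ =
    cong (λ x → f [] * h (c ∷ w) + x) (⊛-vanishingʳ n (f ∘ (c ∷_)) w h≈0 (≤-reflexive |w|≡))

  length-∷ʳ : ∀ (xs : List A) x → length (xs ∷ʳ x) ≡ suc (length xs)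
  length-∷ʳ []       x = refl
  length-∷ʳ (y ∷ xs) x = cong suc (length-∷ʳ xs x)

  ∑ : (A → ℤ) → List A → ℤ
  ∑ F []       = 0ℤ
  ∑ F (x ∷ xs) = F x + ∑ F xs

  ∑-∷ʳ : ∀ F xs x → ∑ F (xs ∷ʳ x) ≡ ∑ F (x ∷ xs)
  ∑-∷ʳ F []       x = refl
  ∑-∷ʳ F (y ∷ xs) x = begin
    F y + ∑ F (xs ∷ʳ x)      ≡⟨ cong (λ z → F y + z) (∑-∷ʳ F xs x) ⟩
    F y + (F x + ∑ F xs)     ≡⟨ ring (F x) (F y) (∑ F xs) ⟩
    F x + (F y + ∑ F xs)     ∎
    where
    ring : ∀ a b s → b + (a + s) ≡ a + (b + s)
    ring = solve-∀

  ∑-cong : ∀ {F G} → (∀ x → F x ≡ G x) → ∀ xs → ∑ F xs ≡ ∑ G xs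
  ∑-cong F≗G []       = refl
  ∑-cong F≗G (x ∷ xs) = cong₂ _+_ (F≗G x) (∑-cong F≗G xs)

∑-map : ∀ {a b} {A : Set a} {B : Set b} F (s : B → A) xs → ∑ F (map s xs) ≡ ∑ (F ∘ s) xs
∑-map F s []       = refl
∑-map F s (x ∷ xs) = cong (λ z → F (s x) + z) (∑-map F s xs)

-- Binomial coefficients of words

module _ {m : ℕ} where

  binomᶻ : List (Fin m) → List (Fin m) → ℤ
  binomᶻ u w = + binom u w

  binom-++ : ∀ u v w → binomᶻ (u ++ v) w ≡ (binomᶻ u ⊛ binomᶻ v) w
  binom-++ []      v []      = refl
  binom-++ []      v (c ∷ w) =
    sym (trans (cong (λ x → 1ℤ * binomᶻ v (c ∷ w) + x) (⊛-zeroˡ (binomᶻ v) w)) (ring (binomᶻ v (c ∷ w))))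
    where
    ring : ∀ x → 1ℤ * x + 0ℤ ≡ x
    ring = solve-∀
  binom-++ (a ∷ u) v []      = refl
  binom-++ (a ∷ u) v (c ∷ w) with a ≟ c
  ... | yes _ = begin
    + (binom (u ++ v) w ℕ.+ binom (u ++ v) (c ∷ w))
      ≡⟨ pos-+ (binom (u ++ v) w) _ ⟩
    binomᶻ (u ++ v) w + binomᶻ (u ++ v) (c ∷ w)
      ≡⟨ cong₂ _+_ (binom-++ u v w) (binom-++ u v (c ∷ w)) ⟩
    (Bu ⊛ Bv) w + (1ℤ * Bv (c ∷ w) + ((Bu ∘ (c ∷_)) ⊛ Bv) w)
      ≡⟨ ring ((Bu ⊛ Bv) w) (Bv (c ∷ w)) _ ⟩
    1ℤ * Bv (c ∷ w) + ((Bu ⊛ Bv) w + ((Bu ∘ (c ∷_)) ⊛ Bv) w)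
      ≡⟨ cong (λ x → 1ℤ * Bv (c ∷ w) + x) (⊛-distribʳ-+ Bu (Bu ∘ (c ∷_)) Bv w) ⟨
    1ℤ * Bv (c ∷ w) + ((λ p → Bu p + Bu (c ∷ p)) ⊛ Bv) w
      ≡⟨ cong (λ x → 1ℤ * Bv (c ∷ w) + x) (⊛-cong w (λ p _ → sym (pos-+ (binom u p) _)) (λ _ _ → refl)) ⟩
    1ℤ * Bv (c ∷ w) + ((λ p → + (binom u p ℕ.+ binom u (c ∷ p))) ⊛ Bv) w ∎
    where
    Bu = binomᶻ u
    Bv = binomᶻ v
    ring : ∀ x y z → x + (1ℤ * y + z) ≡ 1ℤ * y + (x + z)
    ring = solve-∀
  ... | no _ = binom-++ u v (c ∷ w)

  ∼-++ : ∀ {n} {u u′ v v′ : List (Fin m)} → u ∼[ n ] u′ → v ∼[ n ] v′ → (u ++ v) ∼[ n ] (u′ ++ v′)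
  ∼-++ {n} {u} {u′} {v} {v′} u∼u′ v∼v′ z |z|≤n = +-injective (begin
    binomᶻ (u ++ v) z          ≡⟨ binom-++ u v z ⟩
    (binomᶻ u ⊛ binomᶻ v) z    ≡⟨ ⊛-cong z (agree u∼u′) (agree v∼v′) ⟩
    (binomᶻ u′ ⊛ binomᶻ v′) z  ≡⟨ binom-++ u′ v′ z ⟨
    binomᶻ (u′ ++ v′) z        ∎)
    where
    agree : ∀ {x y} → x ∼[ n ] y → ∀ p → length p ≤ length z → binomᶻ x p ≡ binomᶻ y p
    agree x∼y p |p|≤ = cong +_ (x∼y p (≤-trans |p|≤ |z|≤n))

  ∼⇒vanishes : ∀ {n} {u v : List (Fin m)} → u ∼[ n ] v → VanishesUpTo n (λ p → binomᶻ u p - binomᶻ v p)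
  ∼⇒vanishes u∼v p |p|≤n = i≡j⇒i-j≡0 (cong +_ (u∼v p |p|≤n))

  binom-++-difference : ∀ x y u v w →
    binomᶻ (x ++ u) w - binomᶻ (y ++ v) w ≡
    ((λ p → binomᶻ x p - binomᶻ y p) ⊛ binomᶻ u) w + (binomᶻ y ⊛ (λ q → binomᶻ u q - binomᶻ v q)) w
  binom-++-difference x y u v w =
    trans (cong₂ _-_ (binom-++ x u w) (binom-++ y v w)) (⊛-difference _ _ _ _ w)

  δ : Fin m → Fin m → ℕ
  δ a b = if ⌊ a ≟ b ⌋ then 1 else 0

  δ-refl : ∀ a → δ a a ≡ 1
  δ-refl a with a ≟ a
  ... | yes _  = refl
  ... | no a≢a = ⊥-elim (a≢a refl)

  δ-comm : ∀ a b → δ a b ≡ δ b a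
  δ-comm a b with a ≟ b | b ≟ a
  ... | yes _   | yes _   = refl
  ... | no _    | no _    = refl
  ... | yes a≡b | no b≢a  = ⊥-elim (b≢a (sym a≡b))
  ... | no a≢b  | yes b≡a = ⊥-elim (a≢b (sym b≡a))

  ≟-injective : ∀ {s : Fin m → Fin m} → Injective _≡_ _≡_ s → ∀ a b → ⌊ s a ≟ s b ⌋ ≡ ⌊ a ≟ b ⌋
  ≟-injective {s} s-inj a b with s a ≟ s b | a ≟ b
  ... | yes _     | yes _   = refl
  ... | no _      | no _    = refl
  ... | yes sa≡sb | no a≢b  = ⊥-elim (a≢b (s-inj sa≡sb))
  ... | no sa≢sb  | yes a≡b = ⊥-elim (sa≢sb (cong s a≡b))

  δ-injective : ∀ {s : Fin m → Fin m} → Injective _≡_ _≡_ s → ∀ a b → δ (s a) (s b) ≡ δ a b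
  δ-injective s-inj a b = cong (if_then 1 else 0) (≟-injective s-inj a b)

  count-++ : ∀ a u v → count a (u ++ v) ≡ count a u ℕ.+ count a v
  count-++ a []      v = refl
  count-++ a (x ∷ u) v = trans (cong (δ a x ℕ.+_) (count-++ a u v)) (sym (+-assoc (δ a x) _ _))

  count-∷ʳ : ∀ a u x → count a (u ∷ʳ x) ≡ count a (x ∷ u)
  count-∷ʳ a u x = begin
    count a (u ++ [ x ])           ≡⟨ count-++ a u [ x ] ⟩
    count a u ℕ.+ (δ a x ℕ.+ 0)    ≡⟨ cong (count a u ℕ.+_) (ℕₚ.+-identityʳ (δ a x)) ⟩
    count a u ℕ.+ δ a x            ≡⟨ +-comm (count a u) (δ a x) ⟩
    δ a x ℕ.+ count a u            ∎

  binom-singleton : ∀ u c → binom u [ c ] ≡ count c u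
  binom-singleton []      c = refl
  binom-singleton (x ∷ u) c = cong₂ ℕ._+_ (δ-comm x c) (binom-singleton u c)

  count-map : ∀ {s : Fin m → Fin m} → Injective _≡_ _≡_ s → ∀ a u → count (s a) (map s u) ≡ count a u
  count-map s-inj a []      = refl
  count-map s-inj a (x ∷ u) = cong₂ ℕ._+_ (δ-injective s-inj a x) (count-map s-inj a u)

  binom-map : ∀ {s : Fin m → Fin m} → Injective _≡_ _≡_ s → ∀ u w → binom (map s u) (map s w) ≡ binom u w
  binom-map s-inj u       []      = refl
  binom-map s-inj []      (b ∷ w) = refl
  binom-map s-inj (a ∷ u) (b ∷ w) rewrite ≟-injective s-inj a b with ⌊ a ≟ b ⌋
  ... | true  = cong₂ ℕ._+_ (binom-map s-inj u w) (binom-map s-inj u (b ∷ w))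
  ... | false = binom-map s-inj u (b ∷ w)

  ∼-map : ∀ {n} {s s⁻ : Fin m → Fin m} {u v} → Injective _≡_ _≡_ s → (∀ x → s (s⁻ x) ≡ x) →
          u ∼[ n ] v → map s u ∼[ n ] map s v
  ∼-map {s = s} {s⁻} {u} {v} s-inj s∘s⁻ u∼v z |z|≤n = begin
    binom (map s u) z                    ≡⟨ cong (binom (map s u)) s∘s⁻-z ⟨
    binom (map s u) (map s (map s⁻ z))   ≡⟨ binom-map s-inj u (map s⁻ z) ⟩
    binom u (map s⁻ z)                   ≡⟨ u∼v (map s⁻ z) (≤-trans (≤-reflexive (length-map s⁻ z)) |z|≤n) ⟩
    binom v (map s⁻ z)                   ≡⟨ binom-map s-inj v (map s⁻ z) ⟨
    binom (map s v) (map s (map s⁻ z))   ≡⟨ cong (binom (map s v)) s∘s⁻-z ⟩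
    binom (map s v) z                    ∎
    where
    s∘s⁻-z : map s (map s⁻ z) ≡ z
    s∘s⁻-z = trans (sym (map-∘ z)) (trans (map-cong s∘s⁻ z) (map-id z))

  count-applyUpTo-∉ : ∀ (c : Fin m) f n → (∀ j → j < n → f j ≢ c) → count c (applyUpTo f n) ≡ 0
  count-applyUpTo-∉ c f zero    _   = refl
  count-applyUpTo-∉ c f (suc n) f≢c with c ≟ f 0
  ... | yes c≡f0 = ⊥-elim (f≢c 0 (s≤s z≤n) (sym c≡f0))
  ... | no _     = count-applyUpTo-∉ c (f ∘ suc) n (λ j j<n → f≢c (suc j) (s≤s j<n))

  binomᶻ-∷ : ∀ x u a w → binomᶻ (x ∷ u) (a ∷ w) ≡ + δ x a * binomᶻ u w + binomᶻ u (a ∷ w)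
  binomᶻ-∷ x u a w with x ≟ a
  ... | yes _ = trans (pos-+ (binom u w) _) (cong (_+ binomᶻ u (a ∷ w)) (sym (*-identityˡ (binomᶻ u w))))
  ... | no _  = refl

  binom-rotate-pair : ∀ x R a b →
    binomᶻ (x ∷ R) (a ∷ b ∷ []) - binomᶻ (R ∷ʳ x) (a ∷ b ∷ []) ≡
    + δ x a * binomᶻ R [ b ] - binomᶻ R [ a ] * + δ x b
  binom-rotate-pair x R a b = begin
    binomᶻ (x ∷ R) P - binomᶻ (R ++ [ x ]) P
      ≡⟨ cong₂ _-_ (binomᶻ-∷ x R a [ b ]) (binom-++ R [ x ] P) ⟩
    (+ δ x a * binomᶻ R [ b ] + binomᶻ R P)
      - (1ℤ * binomᶻ [ x ] P + (binomᶻ R [ a ] * binomᶻ [ x ] [ b ] + binomᶻ R P * 1ℤ))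
      ≡⟨ cong₂ (λ s t → (+ δ x a * binomᶻ R [ b ] + binomᶻ R P)
                         - (1ℤ * s + (binomᶻ R [ a ] * t + binomᶻ R P * 1ℤ)))
               (binomᶻ-∷ x [] a [ b ]) (binomᶻ-∷ x [] b []) ⟩
    (+ δ x a * binomᶻ R [ b ] + binomᶻ R P)
      - (1ℤ * (+ δ x a * 0ℤ + 0ℤ) + (binomᶻ R [ a ] * (+ δ x b * 1ℤ + 0ℤ) + binomᶻ R P * 1ℤ))
      ≡⟨ ring (+ δ x a) (+ δ x b) (binomᶻ R [ a ]) (binomᶻ R [ b ]) (binomᶻ R P) ⟩
    + δ x a * binomᶻ R [ b ] - binomᶻ R [ a ] * + δ x b ∎
    where
    P = a ∷ b ∷ []
    ring : ∀ d e r s q → (d * s + q) - (1ℤ * (d * 0ℤ + 0ℤ) + (r * (e * 1ℤ + 0ℤ) + q * 1ℤ)) ≡ d * s - r * e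
    ring = solve-∀

  ∑-affine : ∀ {F : Fin m → ℤ} c z M → (∀ x → F x ≡ z + + δ c x * M) →
             ∀ u → ∑ F u ≡ + length u * z + + count c u * M
  ∑-affine c z M F-affine []      = ring z M
    where
    ring : ∀ z M → 0ℤ ≡ 0ℤ * z + 0ℤ * M
    ring = solve-∀
  ∑-affine {F} c z M F-affine (x ∷ u) = begin
    F x + ∑ F u
      ≡⟨ cong₂ _+_ (F-affine x) (∑-affine c z M F-affine u) ⟩
    (z + + δ c x * M) + (+ length u * z + + count c u * M)
      ≡⟨ ring z M (+ δ c x) (+ length u) (+ count c u) ⟩
    (1ℤ + + length u) * z + (+ δ c x + + count c u) * M
      ≡⟨ cong₂ (λ l n → l * z + n * M) (pos-+ 1 (length u)) (pos-+ (δ c x) (count c u)) ⟨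
    + length (x ∷ u) * z + + count c (x ∷ u) * M ∎
    where
    ring : ∀ z M d l n → (z + d * M) + (l * z + n * M) ≡ (1ℤ + l) * z + (d + n) * M
    ring = solve-∀

  count⇒∼₁ : ∀ {u v : List (Fin m)} → (∀ c → count c u ≡ count c v) → u ∼[ 1 ] v
  count⇒∼₁         counts []          _         = refl
  count⇒∼₁ {u} {v} counts (c ∷ [])    _         =
    trans (binom-singleton u c) (trans (counts c) (sym (binom-singleton v c)))
  count⇒∼₁         counts (_ ∷ _ ∷ _) (s≤s ())

-- Letters modulo m and the morphism σ

module _ {m : ℕ} .{{_ : NonZero m}} where

  toℕ-letter : ∀ a → toℕ (letter m a) ≡ a % m
  toℕ-letter a = toℕ-fromℕ< (m%n<n a m)

  letter-cong : ∀ {a b} → a % m ≡ b % m → letter m a ≡ letter m b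
  letter-cong {a} {b} a≡b = fromℕ<-cong (a % m) (b % m) a≡b (m%n<n a m) (m%n<n b m)

  letter-toℕ : ∀ x → letter m (toℕ x) ≡ x
  letter-toℕ x = trans (fromℕ<-cong _ _ (m<n⇒m%n≡m (toℕ<n x)) (m%n<n (toℕ x) m) (toℕ<n x))
                       (fromℕ<-toℕ x (toℕ<n x))

  letter-+-* : ∀ a k → letter m (a ℕ.+ k ℕ.* m) ≡ letter m a
  letter-+-* a k = letter-cong ([m+kn]%n≡m%n a k m)

  letter-injective-< : ∀ {a b} → a < m → b < m → letter m a ≡ letter m b → a ≡ b
  letter-injective-< {a} {b} a<m b<m a≡b = begin
    a                   ≡⟨ m<n⇒m%n≡m a<m ⟨
    a % m               ≡⟨ toℕ-letter a ⟨
    toℕ (letter m a)    ≡⟨ cong toℕ a≡b ⟩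
    toℕ (letter m b)    ≡⟨ toℕ-letter b ⟩
    b % m               ≡⟨ m<n⇒m%n≡m b<m ⟩
    b                   ∎

  shift : ℕ → Fin m → Fin m
  shift t x = letter m (toℕ x ℕ.+ t)

  next : Fin m → Fin m
  next = shift 1

  shift-letter : ∀ t a → shift t (letter m a) ≡ letter m (a ℕ.+ t)
  shift-letter t a = letter-cong (begin
    (toℕ (letter m a) ℕ.+ t) % m    ≡⟨ cong (λ r → (r ℕ.+ t) % m) (toℕ-letter a) ⟩
    (a % m ℕ.+ t) % m               ≡⟨ %-distribˡ-+ (a % m) t m ⟩
    (a % m % m ℕ.+ t % m) % m       ≡⟨ cong (λ r → (r ℕ.+ t % m) % m) (m%n%n≡m%n a m) ⟩
    (a % m ℕ.+ t % m) % m           ≡⟨ %-distribˡ-+ a t m ⟨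
    (a ℕ.+ t) % m                   ∎)

  shift-shift : ∀ s t x → shift s (shift t x) ≡ shift (t ℕ.+ s) x
  shift-shift s t x = trans (shift-letter s (toℕ x ℕ.+ t)) (cong (letter m) (+-assoc (toℕ x) t s))

  shift-zero : ∀ x → shift 0 x ≡ x
  shift-zero x = trans (cong (letter m) (ℕₚ.+-identityʳ (toℕ x))) (letter-toℕ x)

  shift-* : ∀ k x → shift (k ℕ.* m) x ≡ x
  shift-* k x = trans (letter-+-* (toℕ x) k) (letter-toℕ x)

  shift-m : ∀ x → shift m x ≡ x
  shift-m x = trans (cong (λ t → shift t x) (sym (ℕₚ.*-identityˡ m))) (shift-* 1 x)

  shift-inverseˡ : ∀ t x → shift (t ℕ.* pred m) (shift t x) ≡ x
  shift-inverseˡ t x = begin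
    shift (t ℕ.* pred m) (shift t x)   ≡⟨ shift-shift (t ℕ.* pred m) t x ⟩
    shift (t ℕ.+ t ℕ.* pred m) x       ≡⟨ cong (λ s → shift s x) t+t*pred[m]≡t*m ⟩
    shift (t ℕ.* m) x                  ≡⟨ shift-* t x ⟩
    x                                  ∎
    where
    t+t*pred[m]≡t*m : t ℕ.+ t ℕ.* pred m ≡ t ℕ.* m
    t+t*pred[m]≡t*m = trans (sym (ℕₚ.*-suc t (pred m))) (cong (t ℕ.*_) (suc-pred m))

  shift-comm : ∀ s t x → shift s (shift t x) ≡ shift t (shift s x)
  shift-comm s t x = trans (shift-shift s t x) (trans (cong (λ r → shift r x) (+-comm t s)) (sym (shift-shift t s x)))

  shift-inverseʳ : ∀ t x → shift t (shift (t ℕ.* pred m) x) ≡ x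
  shift-inverseʳ t x = trans (shift-comm t (t ℕ.* pred m) x) (shift-inverseˡ t x)

  shift-injective : ∀ t → Injective _≡_ _≡_ (shift t)
  shift-injective t {x} {y} tx≡ty = begin
    x                                   ≡⟨ shift-inverseˡ t x ⟨
    shift (t ℕ.* pred m) (shift t x)    ≡⟨ cong (shift (t ℕ.* pred m)) tx≡ty ⟩
    shift (t ℕ.* pred m) (shift t y)    ≡⟨ shift-inverseˡ t y ⟩
    y                                   ∎

  shift-complement : ∀ c → shift (m ∸ toℕ c) c ≡ letter m 0
  shift-complement c = begin
    letter m (toℕ c ℕ.+ (m ∸ toℕ c))   ≡⟨ cong (letter m) (m+[n∸m]≡n (ℕₚ.<⇒≤ (toℕ<n c))) ⟩
    letter m m                          ≡⟨ cong (letter m) (ℕₚ.+-identityʳ m) ⟨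
    letter m (0 ℕ.+ 1 ℕ.* m)            ≡⟨ letter-+-* 0 1 ⟩
    letter m 0                          ∎

  shift-negLetter : ∀ i → shift i (negLetter m i) ≡ letter m 0
  shift-negLetter i = begin
    shift i (letter m (m ∸ i % m))            ≡⟨ shift-letter i (m ∸ i % m) ⟩
    letter m (m ∸ i % m ℕ.+ i)                ≡⟨ cong (letter m) m∸i%m+i≡[1+i/m]*m ⟩
    letter m (0 ℕ.+ suc (i / m) ℕ.* m)        ≡⟨ letter-+-* 0 (suc (i / m)) ⟩
    letter m 0                                ∎
    where
    m∸i%m+i≡[1+i/m]*m : m ∸ i % m ℕ.+ i ≡ suc (i / m) ℕ.* m
    m∸i%m+i≡[1+i/m]*m = begin
      m ∸ i % m ℕ.+ i                          ≡⟨ cong (m ∸ i % m ℕ.+_) (m≡m%n+[m/n]*n i m) ⟩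
      m ∸ i % m ℕ.+ (i % m ℕ.+ i / m ℕ.* m)    ≡⟨ +-assoc (m ∸ i % m) (i % m) _ ⟨
      m ∸ i % m ℕ.+ i % m ℕ.+ i / m ℕ.* m      ≡⟨ cong (ℕ._+ i / m ℕ.* m) (m∸n+n≡m (ℕₚ.<⇒≤ (m%n<n i m))) ⟩
      m ℕ.+ i / m ℕ.* m                        ∎

  next-negLetter : ∀ i → next (negLetter m (suc i)) ≡ negLetter m i
  next-negLetter i = shift-injective i (begin
    shift i (shift 1 (negLetter m (suc i)))   ≡⟨ shift-shift i 1 (negLetter m (suc i)) ⟩
    shift (suc i) (negLetter m (suc i))       ≡⟨ shift-negLetter (suc i) ⟩
    letter m 0                                ≡⟨ shift-negLetter i ⟨
    shift i (negLetter m i)                   ∎)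

  negLetter-zero : negLetter m 0 ≡ letter m 0
  negLetter-zero = trans (sym (shift-zero (negLetter m 0))) (shift-negLetter 0)

  shift-≢ : ∀ {t} x → 0 < t → t < m → shift t x ≢ x
  shift-≢ {t} x 0<t t<m tx≡x = ℕₚ.<⇒≢ 0<t (sym (letter-injective-< t<m (ℕₚ.<-trans 0<t t<m) letter-t≡letter-0))
    where
    letter-t≡letter-0 : letter m t ≡ letter m 0
    letter-t≡letter-0 = shift-injective (toℕ x) (begin
      shift (toℕ x) (letter m t)   ≡⟨ shift-letter (toℕ x) t ⟩
      letter m (t ℕ.+ toℕ x)       ≡⟨ cong (letter m) (+-comm t (toℕ x)) ⟩
      shift t x                    ≡⟨ tx≡x ⟩
      x                            ≡⟨ letter-toℕ x ⟨
      letter m (toℕ x)             ≡⟨ shift-letter (toℕ x) 0 ⟨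
      shift (toℕ x) (letter m 0)   ∎)

  next-invariant : ∀ {a} {A : Set a} (f : Fin m → A) → (∀ x → f (next x) ≡ f x) → ∀ x y → f x ≡ f y
  next-invariant f f∘next≗f x y = begin
    f x                   ≡⟨ cong f (letter-toℕ x) ⟨
    f (letter m (toℕ x))  ≡⟨ from-zero (toℕ x) ⟩
    f (letter m 0)        ≡⟨ from-zero (toℕ y) ⟨
    f (letter m (toℕ y))  ≡⟨ cong f (letter-toℕ y) ⟩
    f y                   ∎
    where
    from-zero : ∀ j → f (letter m j) ≡ f (letter m 0)
    from-zero zero    = refl
    from-zero (suc j) = begin
      f (letter m (suc j))      ≡⟨ cong (f ∘ letter m) (+-comm 1 j) ⟩
      f (letter m (j ℕ.+ 1))    ≡⟨ cong f (shift-letter 1 j) ⟨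
      f (next (letter m j))     ≡⟨ f∘next≗f (letter m j) ⟩
      f (letter m j)            ≡⟨ from-zero j ⟩
      f (letter m 0)            ∎

  σ-tail : Fin m → List (Fin m)
  σ-tail x = applyUpTo (λ j → shift (suc j) x) (pred m)

  σ-∷ : ∀ x → σ m x ≡ x ∷ σ-tail x
  σ-∷ x = begin
    map (λ j → shift j x) (upTo m)               ≡⟨ map-upTo _ m ⟩
    applyUpTo (λ j → shift j x) m                ≡⟨ cong (applyUpTo (λ j → shift j x)) (suc-pred m) ⟨
    applyUpTo (λ j → shift j x) (suc (pred m))   ≡⟨ cong (_∷ σ-tail x) (shift-zero x) ⟩
    x ∷ σ-tail x                                 ∎

  σ-next : ∀ x → σ m (next x) ≡ σ-tail x ∷ʳ x
  σ-next x = begin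
    map (λ j → shift j (next x)) (upTo m)              ≡⟨ map-cong (λ j → shift-shift j 1 x) (upTo m) ⟩
    map (λ j → shift (suc j) x) (upTo m)               ≡⟨ map-upTo _ m ⟩
    applyUpTo (λ j → shift (suc j) x) m                ≡⟨ cong (applyUpTo _) (suc-pred m) ⟨
    applyUpTo (λ j → shift (suc j) x) (suc (pred m))   ≡⟨ applyUpTo-∷ʳ _ (pred m) ⟨
    σ-tail x ∷ʳ shift (suc (pred m)) x                 ≡⟨ cong (λ t → σ-tail x ∷ʳ shift t x) (suc-pred m) ⟩
    σ-tail x ∷ʳ shift m x                              ≡⟨ cong (σ-tail x ∷ʳ_) (shift-m x) ⟩
    σ-tail x ∷ʳ x                                      ∎

  length-σ : ∀ x → length (σ m x) ≡ m
  length-σ x = trans (length-map _ (upTo m)) (length-upTo m)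

  σ-rotation-invariant : ∀ {a} {A : Set a} (Φ : List (Fin m) → A) → (∀ x u → Φ (u ∷ʳ x) ≡ Φ (x ∷ u)) →
                         ∀ x y → Φ (σ m x) ≡ Φ (σ m y)
  σ-rotation-invariant Φ Φ-rot = next-invariant (Φ ∘ σ m) (λ x → begin
    Φ (σ m (next x))     ≡⟨ cong Φ (σ-next x) ⟩
    Φ (σ-tail x ∷ʳ x)    ≡⟨ Φ-rot x (σ-tail x) ⟩
    Φ (x ∷ σ-tail x)     ≡⟨ cong Φ (σ-∷ x) ⟨
    Φ (σ m x)            ∎)

  count-σ : ∀ c x → count c (σ m x) ≡ 1
  count-σ c x = begin
    count c (σ m x)                        ≡⟨ σ-rotation-invariant (count c) (λ y u → count-∷ʳ c u y) x c ⟩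
    count c (σ m c)                        ≡⟨ cong (count c) (σ-∷ c) ⟩
    δ c c ℕ.+ count c (σ-tail c)           ≡⟨ cong₂ ℕ._+_ (δ-refl c) (count-applyUpTo-∉ c _ (pred m) tail≢c) ⟩
    1                                      ∎
    where
    tail≢c : ∀ j → j < pred m → shift (suc j) c ≢ c
    tail≢c j j<pred[m] = shift-≢ c (s≤s z≤n) (ℕₚ.<-≤-trans (s≤s j<pred[m]) (≤-reflexive (suc-pred m)))

  binomᶻ-σ-tail : ∀ c x → binomᶻ (σ-tail x) [ c ] ≡ 1ℤ - + δ c x
  binomᶻ-σ-tail c x = begin
    + binom (σ-tail x) [ c ]                        ≡⟨ cong +_ (binom-singleton (σ-tail x) c) ⟩
    + count c (σ-tail x)                            ≡⟨ add-sub (+ δ c x) (+ count c (σ-tail x)) ⟩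
    (+ δ c x + + count c (σ-tail x)) - + δ c x      ≡⟨ cong (λ z → z - + δ c x) (pos-+ (δ c x) (count c (σ-tail x))) ⟨
    + count c (x ∷ σ-tail x) - + δ c x              ≡⟨ cong (λ l → + count c l - + δ c x) (σ-∷ x) ⟨
    + count c (σ m x) - + δ c x                     ≡⟨ cong (λ z → + z - + δ c x) (count-σ c x) ⟩
    1ℤ - + δ c x                                    ∎
    where
    add-sub : ∀ d r → r ≡ (d + r) - d
    add-sub = solve-∀

  σ-shift : ∀ t x → map (shift t) (σ m x) ≡ σ m (shift t x)
  σ-shift t x = begin
    map (shift t) (map (λ j → shift j x) (upTo m))   ≡⟨ map-∘ (upTo m) ⟨
    map (λ j → shift t (shift j x)) (upTo m)         ≡⟨ map-cong (λ j → shift-comm t j x) (upTo m) ⟩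
    map (λ j → shift j (shift t x)) (upTo m)         ∎

  σ*-shift : ∀ t u → map (shift t) (σ* m u) ≡ σ* m (map (shift t) u)
  σ*-shift t []      = refl
  σ*-shift t (x ∷ u) = trans (map-++ (shift t) (σ m x) (σ* m u)) (cong₂ _++_ (σ-shift t x) (σ*-shift t u))

  σ^-shift : ∀ t k u → map (shift t) (σ^ m k u) ≡ σ^ m k (map (shift t) u)
  σ^-shift t zero    u = refl
  σ^-shift t (suc k) u = trans (σ*-shift t (σ^ m k u)) (cong (σ* m) (σ^-shift t k u))

  σ^-++ : ∀ k u v → σ^ m k (u ++ v) ≡ σ^ m k u ++ σ^ m k v
  σ^-++ zero    u v = refl
  σ^-++ (suc k) u v = trans (cong (σ* m) (σ^-++ k u v)) (concatMap-++ (σ m) (σ^ m k u) (σ^ m k v))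

  σ^-[] : ∀ k → σ^ m k [] ≡ []
  σ^-[] zero    = refl
  σ^-[] (suc k) = cong (σ* m) (σ^-[] k)

  σ^-σ* : ∀ k u → σ^ m k (σ* m u) ≡ σ* m (σ^ m k u)
  σ^-σ* zero    u = refl
  σ^-σ* (suc k) u = cong (σ* m) (σ^-σ* k u)

  block : ℕ → Fin m → List (Fin m)
  block k x = σ^ m k [ x ]

  σ^-∷ : ∀ k x u → σ^ m k (x ∷ u) ≡ block k x ++ σ^ m k u
  σ^-∷ k x u = σ^-++ k [ x ] u

  block-suc : ∀ k x → block (suc k) x ≡ σ^ m k (σ m x)
  block-suc k x = trans (sym (σ^-σ* k [ x ])) (cong (σ^ m k) (++-identityʳ (σ m x)))

  count-σ^ : ∀ {n} k c → (∀ x → count c (block k x) ≡ n) → ∀ u → count c (σ^ m k u) ≡ n ℕ.* length u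
  count-σ^ {n} k c counts []      = trans (cong (count c) (σ^-[] k)) (sym (ℕₚ.*-zeroʳ n))
  count-σ^ {n} k c counts (x ∷ u) = begin
    count c (σ^ m k (x ∷ u))                         ≡⟨ cong (count c) (σ^-∷ k x u) ⟩
    count c (block k x ++ σ^ m k u)                  ≡⟨ count-++ c (block k x) (σ^ m k u) ⟩
    count c (block k x) ℕ.+ count c (σ^ m k u)       ≡⟨ cong₂ ℕ._+_ (counts x) (count-σ^ k c counts u) ⟩
    n ℕ.+ n ℕ.* length u                             ≡⟨ ℕₚ.*-suc n (length u) ⟨
    n ℕ.* suc (length u)                             ∎

  -- Expansions of binom(σᵏ(u), p)

  σ^-∼ : ∀ {n} k → (∀ x y → block k x ∼[ n ] block k y) →
         ∀ u v → length u ≡ length v → σ^ m k u ∼[ n ] σ^ m k v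
  σ^-∼ k equiv []      []      _  z _ = refl
  σ^-∼ {n} k equiv (x ∷ u) (y ∷ v) eq =
    subst₂ (λ a b → a ∼[ n ] b) (sym (σ^-∷ k x u)) (sym (σ^-∷ k y v))
           (∼-++ (equiv x y) (σ^-∼ k equiv u v (suc-injective eq)))

  BlocksEquivalent : ℕ → Set
  BlocksEquivalent k = ∀ x y → block k x ∼[ k ] block k y

  binom-σ^-difference : ∀ k → BlocksEquivalent k → ∀ u v → length u ≡ length v →
    ∀ p → length p ≤ suc k →
    binomᶻ (σ^ m k u) p - binomᶻ (σ^ m k v) p ≡
    ∑ (λ x → binomᶻ (block k x) p) u - ∑ (λ x → binomᶻ (block k x) p) v
  binom-σ^-difference k equiv []      []      _  p _    = +-inverseʳ (binomᶻ (σ^ m k []) p)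
  binom-σ^-difference k equiv (x ∷ u) (y ∷ v) eq p |p|≤ = begin
    binomᶻ (σ^ m k (x ∷ u)) p - binomᶻ (σ^ m k (y ∷ v)) p
      ≡⟨ cong₂ (λ a b → binomᶻ a p - binomᶻ b p) (σ^-∷ k x u) (σ^-∷ k y v) ⟩
    binomᶻ (block k x ++ σ^ m k u) p - binomᶻ (block k y ++ σ^ m k v) p
      ≡⟨ binom-++-difference (block k x) (block k y) (σ^ m k u) (σ^ m k v) p ⟩
    (Δblock ⊛ binomᶻ (σ^ m k u)) p + (binomᶻ (block k y) ⊛ Δσ^) p
      ≡⟨ cong₂ _+_ (⊛-vanishingˡ k _ p (∼⇒vanishes (equiv x y)) |p|≤)
                   (⊛-vanishingʳ k _ p (∼⇒vanishes (σ^-∼ k equiv u v |u|≡|v|)) |p|≤) ⟩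
    Δblock p * 1ℤ + 1ℤ * Δσ^ p
      ≡⟨ cong (λ z → Δblock p * 1ℤ + 1ℤ * z) (binom-σ^-difference k equiv u v |u|≡|v| p |p|≤) ⟩
    Δblock p * 1ℤ + 1ℤ * (∑ F u - ∑ F v)
      ≡⟨ ring (F x) (F y) (∑ F u) (∑ F v) ⟩
    (F x + ∑ F u) - (F y + ∑ F v) ∎
    where
    |u|≡|v| = suc-injective eq
    F = λ z → binomᶻ (block k z) p
    Δblock = λ q → binomᶻ (block k x) q - binomᶻ (block k y) q
    Δσ^ = λ q → binomᶻ (σ^ m k u) q - binomᶻ (σ^ m k v) q
    ring : ∀ a b s t → (a - b) * 1ℤ + 1ℤ * (s - t) ≡ (a + s) - (b + t)
    ring = solve-∀

  ∑-σ : ∀ F x y → ∑ F (σ m x) ≡ ∑ F (σ m y)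
  ∑-σ F = σ-rotation-invariant (∑ F) (λ x u → ∑-∷ʳ F u x)

  ∑-σ-next : ∀ F x → ∑ (F ∘ next) (σ m x) ≡ ∑ F (σ m x)
  ∑-σ-next F x = begin
    ∑ (F ∘ next) (σ m x)      ≡⟨ ∑-map F next (σ m x) ⟨
    ∑ F (map next (σ m x))    ≡⟨ cong (∑ F) (σ-shift 1 x) ⟩
    ∑ F (σ m (next x))        ≡⟨ ∑-σ F (next x) x ⟩
    ∑ F (σ m x)               ∎

  blocks-equivalent : ∀ k → BlocksEquivalent k
  blocks-equivalent zero    x y []  _    = refl
  blocks-equivalent (suc k) x y p |p|≤ = +-injective (i-j≡0⇒i≡j _ _ (begin
    binomᶻ (block (suc k) x) p - binomᶻ (block (suc k) y) p
      ≡⟨ cong₂ (λ a b → binomᶻ a p - binomᶻ b p) (block-suc k x) (block-suc k y) ⟩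
    binomᶻ (σ^ m k (σ m x)) p - binomᶻ (σ^ m k (σ m y)) p
      ≡⟨ binom-σ^-difference k (blocks-equivalent k) (σ m x) (σ m y) (trans (length-σ x) (sym (length-σ y))) p |p|≤ ⟩
    ∑ F (σ m x) - ∑ F (σ m y)
      ≡⟨ cong (λ z → z - ∑ F (σ m y)) (∑-σ F x y) ⟩
    ∑ F (σ m y) - ∑ F (σ m y)
      ≡⟨ +-inverseʳ (∑ F (σ m y)) ⟩
    0ℤ ∎))
    where
    F = λ z → binomᶻ (block k z) p

  count-block : ∀ k c x → count c (block (suc k) x) ≡ m ^ k
  count-block zero    c x = trans (cong (count c) (block-suc 0 x)) (count-σ c x)
  count-block (suc k) c x = begin
    count c (block (suc (suc k)) x)     ≡⟨ cong (count c) (block-suc (suc k) x) ⟩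
    count c (σ^ m (suc k) (σ m x))      ≡⟨ count-σ^ (suc k) c (count-block k c) (σ m x) ⟩
    m ^ k ℕ.* length (σ m x)            ≡⟨ cong (m ^ k ℕ.*_) (length-σ x) ⟩
    m ^ k ℕ.* m                         ≡⟨ *-comm (m ^ k) m ⟩
    m ^ suc k                           ∎

  module SecondOrder (k : ℕ) (equiv : BlocksEquivalent k) (n : ℕ) (counts : ∀ c x → count c (block k x) ≡ n)
                     (a b : Fin m) (w : List (Fin m)) (|w|≡k : length w ≡ k) where

    awb : List (Fin m)
    awb = a ∷ (w ∷ʳ b)

    full prefix suffix : Fin m → ℤ
    full   x = binomᶻ (block k x) awb
    prefix x = binomᶻ (block k x) (a ∷ w)
    suffix x = binomᶻ (block k x) (w ∷ʳ b)

    -- Up to a term depending only on the length of u, binom(σᵏ(u), a w b) counts the occurrences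
    -- inside one block (full) and those split as (a w | b) or (a | w b) over two blocks, the lone
    -- letter having n occurrences in every block.
    correction : List (Fin m) → ℤ
    correction []      = 0ℤ
    correction (x ∷ u) = correction u + full x + prefix x * (+ n * + length u) + + n * ∑ suffix u

    binomᶻ-σ^-letter : ∀ c u → binomᶻ (σ^ m k u) [ c ] ≡ + n * + length u
    binomᶻ-σ^-letter c u =
      trans (cong +_ (trans (binom-singleton (σ^ m k u) c) (count-σ^ k c (counts c) u))) (pos-* n (length u))

    binom-σ^-difference₂ : ∀ u v → length u ≡ length v →
      binomᶻ (σ^ m k u) awb - binomᶻ (σ^ m k v) awb ≡ correction u - correction v
    binom-σ^-difference₂ []      []      _  = +-inverseʳ (binomᶻ (σ^ m k []) awb)
    binom-σ^-difference₂ (x ∷ u) (y ∷ v) eq = begin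
      binomᶻ (σ^ m k (x ∷ u)) awb - binomᶻ (σ^ m k (y ∷ v)) awb
        ≡⟨ cong₂ (λ s t → binomᶻ s awb - binomᶻ t awb) (σ^-∷ k x u) (σ^-∷ k y v) ⟩
      binomᶻ (block k x ++ σ^ m k u) awb - binomᶻ (block k y ++ σ^ m k v) awb
        ≡⟨ binom-++-difference (block k x) (block k y) (σ^ m k u) (σ^ m k v) awb ⟩
      (Δblock ⊛ binomᶻ (σ^ m k u)) awb + (binomᶻ (block k y) ⊛ Δσ^) awb
        ≡⟨ cong₂ _+_ (⊛-vanishingˡ-∷ʳ k {Δblock} (binomᶻ (σ^ m k u)) (a ∷ w) b blocks-agree (cong suc |w|≡k))
                     (⊛-vanishingʳ-∷ k {Δσ^} (binomᶻ (block k y)) a (w ∷ʳ b) images-agree |w∷ʳb|≡1+k) ⟩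
      (Δblock awb * 1ℤ + Δblock (a ∷ w) * binomᶻ (σ^ m k u) [ b ])
        + (1ℤ * Δσ^ awb + binomᶻ (block k y) [ a ] * Δσ^ (w ∷ʳ b))
        ≡⟨ cong₂ (λ s t → (Δblock awb * 1ℤ + Δblock (a ∷ w) * s) + (1ℤ * Δσ^ awb + t))
                 (binomᶻ-σ^-letter b u)
                 (cong₂ _*_ (binomᶻ-σ^-letter a [ y ]) suffix-difference) ⟩
      (Δblock awb * 1ℤ + Δblock (a ∷ w) * (+ n * + length u))
        + (1ℤ * Δσ^ awb + (+ n * + 1) * (∑ suffix u - ∑ suffix v))
        ≡⟨ cong (λ z → (Δblock awb * 1ℤ + Δblock (a ∷ w) * (+ n * + length u))
                        + (1ℤ * z + (+ n * + 1) * (∑ suffix u - ∑ suffix v)))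
                (binom-σ^-difference₂ u v |u|≡|v|) ⟩
      (Δblock awb * 1ℤ + Δblock (a ∷ w) * (+ n * + length u))
        + (1ℤ * (correction u - correction v) + (+ n * + 1) * (∑ suffix u - ∑ suffix v))
        ≡⟨ ring (full x) (full y) (prefix x) (prefix y) (correction u) (correction v)
                (∑ suffix u) (∑ suffix v) (+ n) (+ length u) ⟩
      (correction u + full x + prefix x * (+ n * + length u) + + n * ∑ suffix u)
        - (correction v + full y + prefix y * (+ n * + length u) + + n * ∑ suffix v)
        ≡⟨ cong (λ l → (correction u + full x + prefix x * (+ n * + length u) + + n * ∑ suffix u)
                       - (correction v + full y + prefix y * (+ n * + l) + + n * ∑ suffix v)) |u|≡|v| ⟩
      correction (x ∷ u) - correction (y ∷ v) ∎
      where
      |u|≡|v| = suc-injective eq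
      |w∷ʳb|≡1+k = trans (length-∷ʳ w b) (cong suc |w|≡k)
      Δblock = λ q → binomᶻ (block k x) q - binomᶻ (block k y) q
      Δσ^ = λ q → binomᶻ (σ^ m k u) q - binomᶻ (σ^ m k v) q

      blocks-agree : VanishesUpTo k Δblock
      blocks-agree = ∼⇒vanishes (equiv x y)

      images-agree : VanishesUpTo k Δσ^
      images-agree = ∼⇒vanishes (σ^-∼ k equiv u v |u|≡|v|)

      suffix-difference : Δσ^ (w ∷ʳ b) ≡ ∑ suffix u - ∑ suffix v
      suffix-difference = binom-σ^-difference k equiv u v |u|≡|v| (w ∷ʳ b) (≤-reflexive |w∷ʳb|≡1+k)

      ring : ∀ fx fy px py cu cv su sv n′ l →
             ((fx - fy) * 1ℤ + (px - py) * (n′ * l)) + (1ℤ * (cu - cv) + (n′ * 1ℤ) * (su - sv))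
             ≡ (cu + fx + px * (n′ * l) + n′ * su) - (cv + fy + py * (n′ * l) + n′ * sv)
      ring = solve-∀

    correction-∷ʳ : ∀ u x →
      correction (u ∷ʳ x) ≡ correction u + full x + + n * ∑ prefix u + + n * (+ length u * suffix x)
    correction-∷ʳ []      x = ring (full x) (prefix x) (suffix x) (+ n)
      where
      ring : ∀ f p s n′ → 0ℤ + f + p * (n′ * 0ℤ) + n′ * 0ℤ ≡ 0ℤ + f + n′ * 0ℤ + n′ * (0ℤ * s)
      ring = solve-∀
    correction-∷ʳ (y ∷ u) x = begin
      correction (u ∷ʳ x) + full y + prefix y * (+ n * + length (u ∷ʳ x)) + + n * ∑ suffix (u ∷ʳ x)
        ≡⟨ cong₂ (λ c s → c + full y + prefix y * (+ n * + length (u ∷ʳ x)) + + n * s)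
                 (correction-∷ʳ u x) (∑-∷ʳ suffix u x) ⟩
      (correction u + full x + + n * ∑ prefix u + + n * (+ length u * suffix x))
        + full y + prefix y * (+ n * + length (u ∷ʳ x)) + + n * (suffix x + ∑ suffix u)
        ≡⟨ cong (λ l → (correction u + full x + + n * ∑ prefix u + + n * (+ length u * suffix x))
                        + full y + prefix y * (+ n * l) + + n * (suffix x + ∑ suffix u))
                (trans (cong +_ (length-∷ʳ u x)) (pos-+ 1 (length u))) ⟩
      (correction u + full x + + n * ∑ prefix u + + n * (+ length u * suffix x))
        + full y + prefix y * (+ n * (1ℤ + + length u)) + + n * (suffix x + ∑ suffix u)
        ≡⟨ ring (correction u) (full x) (full y) (prefix y) (suffix x) (+ n) (+ length u) (∑ prefix u) (∑ suffix u) ⟩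
      (correction u + full y + prefix y * (+ n * + length u) + + n * ∑ suffix u)
        + full x + + n * (prefix y + ∑ prefix u) + + n * ((1ℤ + + length u) * suffix x)
        ≡⟨ cong (λ l → (correction u + full y + prefix y * (+ n * + length u) + + n * ∑ suffix u)
                        + full x + + n * (prefix y + ∑ prefix u) + + n * (l * suffix x)) (pos-+ 1 (length u)) ⟨
      correction (y ∷ u) + full x + + n * ∑ prefix (y ∷ u) + + n * (+ length (y ∷ u) * suffix x) ∎
      where
      ring : ∀ c fx fy py sx n′ l Σp Σs →
             (c + fx + n′ * Σp + n′ * (l * sx)) + fy + py * (n′ * (1ℤ + l)) + n′ * (sx + Σs)
             ≡ (c + fy + py * (n′ * l) + n′ * Σs) + fx + n′ * (py + Σp) + n′ * ((1ℤ + l) * sx)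
      ring = solve-∀

    correction-rotate : ∀ x u →
      correction (x ∷ u) - correction (u ∷ʳ x) ≡
      + n * (+ length (x ∷ u) * (prefix x - suffix x)) + + n * (∑ suffix (x ∷ u) - ∑ prefix (x ∷ u))
    correction-rotate x u = begin
      correction (x ∷ u) - correction (u ∷ʳ x)
        ≡⟨ cong (λ c → correction (x ∷ u) - c) (correction-∷ʳ u x) ⟩
      (correction u + full x + prefix x * (+ n * + length u) + + n * ∑ suffix u)
        - (correction u + full x + + n * ∑ prefix u + + n * (+ length u * suffix x))
        ≡⟨ ring (correction u) (full x) (prefix x) (suffix x) (+ n) (+ length u) (∑ prefix u) (∑ suffix u) ⟩
      + n * ((1ℤ + + length u) * (prefix x - suffix x)) + + n * ((suffix x + ∑ suffix u) - (prefix x + ∑ prefix u))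
        ≡⟨ cong (λ l → + n * (l * (prefix x - suffix x)) + + n * ((suffix x + ∑ suffix u) - (prefix x + ∑ prefix u)))
                (pos-+ 1 (length u)) ⟨
      + n * (+ length (x ∷ u) * (prefix x - suffix x)) + + n * (∑ suffix (x ∷ u) - ∑ prefix (x ∷ u)) ∎
      where
      ring : ∀ c f p s n′ l Σp Σs →
             (c + f + p * (n′ * l) + n′ * Σs) - (c + f + n′ * Σp + n′ * (l * s))
             ≡ n′ * ((1ℤ + l) * (p - s)) + n′ * ((s + Σs) - (p + Σp))
      ring = solve-∀

    σ-next-difference : (∀ y → suffix y ≡ prefix (next y)) → ∀ x →
      binomᶻ (σ^ m k (σ m x)) awb - binomᶻ (σ^ m k (σ m (next x))) awb ≡ + n * (+ m * (prefix x - prefix (next x)))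
    σ-next-difference suffix≡prefix∘next x = begin
      binomᶻ (σ^ m k (σ m x)) awb - binomᶻ (σ^ m k (σ m (next x))) awb
        ≡⟨ cong₂ (λ s t → binomᶻ (σ^ m k s) awb - binomᶻ (σ^ m k t) awb) (σ-∷ x) (σ-next x) ⟩
      binomᶻ (σ^ m k (x ∷ R)) awb - binomᶻ (σ^ m k (R ∷ʳ x)) awb
        ≡⟨ binom-σ^-difference₂ (x ∷ R) (R ∷ʳ x) (sym (length-∷ʳ R x)) ⟩
      correction (x ∷ R) - correction (R ∷ʳ x)
        ≡⟨ correction-rotate x R ⟩
      + n * (+ length (x ∷ R) * (prefix x - suffix x)) + + n * (∑ suffix (x ∷ R) - ∑ prefix (x ∷ R))
        ≡⟨ cong₂ (λ l z → + n * (+ l * (prefix x - suffix x)) + + n * z) |x∷R|≡m (i≡j⇒i-j≡0 ∑suffix≡∑prefix) ⟩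
      + n * (+ m * (prefix x - suffix x)) + + n * 0ℤ
        ≡⟨ ring (+ n) (+ m * (prefix x - suffix x)) ⟩
      + n * (+ m * (prefix x - suffix x))
        ≡⟨ cong (λ s → + n * (+ m * (prefix x - s))) (suffix≡prefix∘next x) ⟩
      + n * (+ m * (prefix x - prefix (next x))) ∎
      where
      R = σ-tail x

      |x∷R|≡m : length (x ∷ R) ≡ m
      |x∷R|≡m = trans (cong length (sym (σ-∷ x))) (length-σ x)

      ∑suffix≡∑prefix : ∑ suffix (x ∷ R) ≡ ∑ prefix (x ∷ R)
      ∑suffix≡∑prefix = begin
        ∑ suffix (x ∷ R)             ≡⟨ ∑-cong suffix≡prefix∘next (x ∷ R) ⟩
        ∑ (prefix ∘ next) (x ∷ R)    ≡⟨ cong (∑ (prefix ∘ next)) (σ-∷ x) ⟨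
        ∑ (prefix ∘ next) (σ m x)    ≡⟨ ∑-σ-next prefix x ⟩
        ∑ prefix (σ m x)             ≡⟨ cong (∑ prefix) (σ-∷ x) ⟩
        ∑ prefix (x ∷ R)             ∎

      ring : ∀ p q → p * q + p * 0ℤ ≡ p * q
      ring = solve-∀

  -- The pattern 0 (-1) ⋯ (-k)

  negLetters : ℕ → List (Fin m)
  negLetters n = map (negLetter m ∘ suc) (upTo n)

  length-negLetters : ∀ n → length (negLetters n) ≡ n
  length-negLetters n = trans (length-map _ (upTo n)) (length-upTo n)

  length-patternWord : ∀ k → length (patternWord m k) ≡ suc k
  length-patternWord k = trans (length-map _ (upTo (suc k))) (length-upTo (suc k))

  patternWord-∷ : ∀ k → patternWord m k ≡ negLetter m 0 ∷ negLetters k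
  patternWord-∷ k = cong (negLetter m 0 ∷_) (trans (map-applyUpTo suc (negLetter m) k) (sym (map-upTo _ k)))

  negLetters-suc : ∀ k → negLetters (suc k) ≡ negLetters k ∷ʳ negLetter m (suc k)
  negLetters-suc k = trans (cong (map (negLetter m ∘ suc)) (sym (upTo-∷ʳ k))) (map-++ _ (upTo k) [ k ])

  patternWord-suc : ∀ k → patternWord m (suc k) ≡ negLetter m 0 ∷ (negLetters k ∷ʳ negLetter m (suc k))
  patternWord-suc k = trans (patternWord-∷ (suc k)) (cong (negLetter m 0 ∷_) (negLetters-suc k))

  next-negLetters : ∀ k → map next (negLetters (suc k)) ≡ patternWord m k
  next-negLetters k = trans (sym (map-∘ (upTo (suc k)))) (map-cong next-negLetter (upTo (suc k)))

  patternBinom : ℕ → Fin m → ℤ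
  patternBinom k x = binomᶻ (block k x) (patternWord m k)

  binom-block-negLetters : ∀ k x → binomᶻ (block k x) (negLetters (suc k)) ≡ patternBinom k (next x)
  binom-block-negLetters k x = cong +_ (begin
    binom (block k x) (negLetters (suc k))
      ≡⟨ binom-map (shift-injective 1) (block k x) (negLetters (suc k)) ⟨
    binom (map next (block k x)) (map next (negLetters (suc k)))
      ≡⟨ cong₂ binom (σ^-shift 1 k [ x ]) (next-negLetters k) ⟩
    binom (block k (next x)) (patternWord m k) ∎)

  patternBinom-next-recurrence : ∀ k x →
    patternBinom (suc (suc k)) x - patternBinom (suc (suc k)) (next x) ≡
    + (m ^ k) * (+ m * (patternBinom (suc k) x - patternBinom (suc k) (next x)))
  patternBinom-next-recurrence k x = begin
    binomᶻ (block (suc K) x) P - binomᶻ (block (suc K) (next x)) P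
      ≡⟨ cong₂ (λ s t → binomᶻ s P - binomᶻ t P) (block-suc K x) (block-suc K (next x)) ⟩
    binomᶻ (σ^ m K (σ m x)) P - binomᶻ (σ^ m K (σ m (next x))) P
      ≡⟨ cong (λ Q → binomᶻ (σ^ m K (σ m x)) Q - binomᶻ (σ^ m K (σ m (next x))) Q) (patternWord-suc K) ⟩
    binomᶻ (σ^ m K (σ m x)) awb - binomᶻ (σ^ m K (σ m (next x))) awb
      ≡⟨ σ-next-difference suffix≡prefix∘next x ⟩
    + (m ^ k) * (+ m * (prefix x - prefix (next x)))
      ≡⟨ cong₂ (λ s t → + (m ^ k) * (+ m * (s - t))) (prefix≡ x) (prefix≡ (next x)) ⟩
    + (m ^ k) * (+ m * (patternBinom K x - patternBinom K (next x))) ∎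
    where
    K = suc k
    P = patternWord m (suc K)
    open SecondOrder K (blocks-equivalent K) (m ^ k) (λ c y → count-block k c y)
                     (negLetter m 0) (negLetter m (suc K)) (negLetters K) (length-negLetters K)

    prefix≡ : ∀ y → prefix y ≡ patternBinom K y
    prefix≡ y = cong (binomᶻ (block K y)) (sym (patternWord-∷ K))

    suffix≡prefix∘next : ∀ y → suffix y ≡ prefix (next y)
    suffix≡prefix∘next y = begin
      binomᶻ (block K y) (negLetters K ∷ʳ negLetter m (suc K))   ≡⟨ cong (binomᶻ (block K y)) (negLetters-suc K) ⟨
      binomᶻ (block K y) (negLetters (suc K))                     ≡⟨ binom-block-negLetters K y ⟩
      patternBinom K (next y)                                     ≡⟨ prefix≡ (next y) ⟨
      prefix (next y)                                             ∎

  NextDifference : ℕ → Set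
  NextDifference k = ∀ x → patternBinom k x - patternBinom k (next x) ≡
                        (+ δ (letter m 0) x - + δ (letter m 0) (next x)) * + (m ^ (k C 2))

  nextDifference-one : NextDifference 1
  nextDifference-one x = begin
    binomᶻ (block 1 x) P - binomᶻ (block 1 (next x)) P
      ≡⟨ cong₂ (λ s t → binomᶻ s P - binomᶻ t P)
               (trans (block-suc 0 x) (σ-∷ x)) (trans (block-suc 0 (next x)) (σ-next x)) ⟩
    binomᶻ (x ∷ R) P - binomᶻ (R ∷ʳ x) P
      ≡⟨ binom-rotate-pair x R a b ⟩
    + δ x a * binomᶻ R [ b ] - binomᶻ R [ a ] * + δ x b
      ≡⟨ cong₂ (λ s t → + δ x a * s - t * + δ x b) (binomᶻ-σ-tail b x) (binomᶻ-σ-tail a x) ⟩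
    + δ x a * (1ℤ - + δ b x) - (1ℤ - + δ a x) * + δ x b
      ≡⟨ cong₂ (λ s t → + s * (1ℤ - + δ b x) - (1ℤ - + δ a x) * + t) (δ-comm x a) (δ-comm x b) ⟩
    + δ a x * (1ℤ - + δ b x) - (1ℤ - + δ a x) * + δ b x
      ≡⟨ ring (+ δ a x) (+ δ b x) ⟩
    (+ δ a x - + δ b x) * 1ℤ
      ≡⟨ cong₂ (λ s t → (+ s - + t) * 1ℤ) (cong (λ c → δ c x) negLetter-zero) δ-b-x ⟩
    (+ δ (letter m 0) x - + δ (letter m 0) (next x)) * 1ℤ ∎
    where
    a = negLetter m 0
    b = negLetter m 1
    P = a ∷ b ∷ []
    R = σ-tail x

    δ-b-x : δ b x ≡ δ (letter m 0) (next x)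
    δ-b-x = trans (sym (δ-injective (shift-injective 1) b x))
                  (cong (λ c → δ c (next x)) (trans (next-negLetter 0) negLetter-zero))

    ring : ∀ p q → p * (1ℤ - q) - (1ℤ - p) * q ≡ (p - q) * 1ℤ
    ring = solve-∀

  m^k*[m*m^[1+k]C2]≡m^[2+k]C2 : ∀ k → m ^ k ℕ.* (m ℕ.* m ^ (suc k C 2)) ≡ m ^ (suc (suc k) C 2)
  m^k*[m*m^[1+k]C2]≡m^[2+k]C2 k = begin
    m ^ k ℕ.* (m ℕ.* m ^ (suc k C 2))   ≡⟨ *-assoc (m ^ k) m _ ⟨
    m ^ k ℕ.* m ℕ.* m ^ (suc k C 2)     ≡⟨ cong (ℕ._* m ^ (suc k C 2)) (*-comm (m ^ k) m) ⟩
    m ^ suc k ℕ.* m ^ (suc k C 2)       ≡⟨ ℕₚ.^-distribˡ-+-* m (suc k) _ ⟨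
    m ^ (suc k ℕ.+ suc k C 2)           ≡⟨ cong (λ z → m ^ (z ℕ.+ suc k C 2)) (nC1≡n (suc k)) ⟨
    m ^ (suc k C 1 ℕ.+ suc k C 2)       ≡⟨ cong (m ^_) (nCk+nC[k+1]≡[n+1]C[k+1] (suc k) 1) ⟩
    m ^ (suc (suc k) C 2)               ∎

  nextDifference : ∀ k → NextDifference (suc k)
  nextDifference zero      = nextDifference-one
  nextDifference (suc k) x = begin
    patternBinom (suc (suc k)) x - patternBinom (suc (suc k)) (next x)
      ≡⟨ patternBinom-next-recurrence k x ⟩
    + (m ^ k) * (+ m * (patternBinom (suc k) x - patternBinom (suc k) (next x)))
      ≡⟨ cong (λ z → + (m ^ k) * (+ m * z)) (nextDifference k x) ⟩
    + (m ^ k) * (+ m * (d * + (m ^ (suc k C 2))))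
      ≡⟨ ring (+ (m ^ k)) (+ m) d (+ (m ^ (suc k C 2))) ⟩
    d * (+ (m ^ k) * (+ m * + (m ^ (suc k C 2))))
      ≡⟨ cong (λ z → d * (+ (m ^ k) * z)) (pos-* m _) ⟨
    d * (+ (m ^ k) * + (m ℕ.* m ^ (suc k C 2)))
      ≡⟨ cong (d *_) (trans (sym (pos-* (m ^ k) (m ℕ.* m ^ (suc k C 2)))) (cong +_ (m^k*[m*m^[1+k]C2]≡m^[2+k]C2 k))) ⟩
    d * + (m ^ (suc (suc k) C 2)) ∎
    where
    d = + δ (letter m 0) x - + δ (letter m 0) (next x)
    ring : ∀ p q e r → p * (q * (e * r)) ≡ e * (p * (q * r))
    ring = solve-∀

  patternBinom-affine : ∀ k x →
    patternBinom (suc k) x ≡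
    (patternBinom (suc k) (letter m 0) - + (m ^ (suc k C 2))) + + δ (letter m 0) x * + (m ^ (suc k C 2))
  patternBinom-affine k x = begin
    patternBinom (suc k) x
      ≡⟨ ring₁ (patternBinom (suc k) x) (+ δ 0ₘ x * M) ⟩
    f x + + δ 0ₘ x * M
      ≡⟨ cong (λ z → z + + δ 0ₘ x * M) (next-invariant f f∘next≗f x 0ₘ) ⟩
    (patternBinom (suc k) 0ₘ - + δ 0ₘ 0ₘ * M) + + δ 0ₘ x * M
      ≡⟨ cong (λ z → (patternBinom (suc k) 0ₘ - z) + + δ 0ₘ x * M)
              (trans (cong (λ d → + d * M) (δ-refl 0ₘ)) (*-identityˡ M)) ⟩
    (patternBinom (suc k) 0ₘ - M) + + δ 0ₘ x * M ∎
    where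
    0ₘ = letter m 0
    M = + (m ^ (suc k C 2))
    f = λ y → patternBinom (suc k) y - + δ 0ₘ y * M

    ring₁ : ∀ g e → g ≡ (g - e) + e
    ring₁ = solve-∀
    ring₂ : ∀ g g′ d d′ M → (g - d * M) - (g′ - d′ * M) ≡ (g - g′) - (d - d′) * M
    ring₂ = solve-∀

    f∘next≗f : ∀ y → f (next y) ≡ f y
    f∘next≗f y = sym (i-j≡0⇒i≡j _ _ (begin
      f y - f (next y)
        ≡⟨ ring₂ (patternBinom (suc k) y) (patternBinom (suc k) (next y)) (+ δ 0ₘ y) (+ δ 0ₘ (next y)) M ⟩
      (patternBinom (suc k) y - patternBinom (suc k) (next y)) - (+ δ 0ₘ y - + δ 0ₘ (next y)) * M
        ≡⟨ cong (λ z → z - (+ δ 0ₘ y - + δ 0ₘ (next y)) * M) (nextDifference k y) ⟩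
      (+ δ 0ₘ y - + δ 0ₘ (next y)) * M - (+ δ 0ₘ y - + δ 0ₘ (next y)) * M
        ≡⟨ +-inverseʳ ((+ δ 0ₘ y - + δ 0ₘ (next y)) * M) ⟩
      0ℤ ∎))

  binom-patternWord-difference : ∀ k u v → length u ≡ length v →
    binomᶻ (σ^ m (suc k) u) (patternWord m (suc k)) - binomᶻ (σ^ m (suc k) v) (patternWord m (suc k)) ≡
    (+ count (letter m 0) u - + count (letter m 0) v) * + (m ^ (suc k C 2))
  binom-patternWord-difference k u v |u|≡|v| = begin
    binomᶻ (σ^ m (suc k) u) P - binomᶻ (σ^ m (suc k) v) P
      ≡⟨ binom-σ^-difference (suc k) (blocks-equivalent (suc k)) u v |u|≡|v| P (≤-reflexive (length-patternWord (suc k))) ⟩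
    ∑ (patternBinom (suc k)) u - ∑ (patternBinom (suc k)) v
      ≡⟨ cong₂ _-_ (∑-affine 0ₘ z M (patternBinom-affine k) u) (∑-affine 0ₘ z M (patternBinom-affine k) v) ⟩
    (+ length u * z + + count 0ₘ u * M) - (+ length v * z + + count 0ₘ v * M)
      ≡⟨ cong (λ l → (+ length u * z + + count 0ₘ u * M) - (+ l * z + + count 0ₘ v * M)) |u|≡|v| ⟨
    (+ length u * z + + count 0ₘ u * M) - (+ length u * z + + count 0ₘ v * M)
      ≡⟨ ring (+ length u) z (+ count 0ₘ u) (+ count 0ₘ v) M ⟩
    (+ count 0ₘ u - + count 0ₘ v) * M ∎
    where
    P = patternWord m (suc k)
    0ₘ = letter m 0
    M = + (m ^ (suc k C 2))
    z = patternBinom (suc k) 0ₘ - M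
    ring : ∀ l z n n′ M → (l * z + n * M) - (l * z + n′ * M) ≡ (n - n′) * M
    ring = solve-∀

  σ^-∼⇒count-zero≡ : ∀ k u v → length u ≡ length v → σ^ m (suc k) u ∼[ suc (suc k) ] σ^ m (suc k) v →
                     count (letter m 0) u ≡ count (letter m 0) v
  σ^-∼⇒count-zero≡ k u v |u|≡|v| σᵏu∼σᵏv = +-injective (i-j≡0⇒i≡j _ _ difference≡0)
    where
    P = patternWord m (suc k)
    M = + (m ^ (suc k C 2))
    difference = + count (letter m 0) u - + count (letter m 0) v

    difference*M≡0 : difference * M ≡ 0ℤ
    difference*M≡0 = begin
      difference * M
        ≡⟨ binom-patternWord-difference k u v |u|≡|v| ⟨
      binomᶻ (σ^ m (suc k) u) P - binomᶻ (σ^ m (suc k) v) P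
        ≡⟨ i≡j⇒i-j≡0 (cong +_ (σᵏu∼σᵏv P (≤-reflexive (length-patternWord (suc k))))) ⟩
      0ℤ ∎

    M≢0 : M ≢ 0ℤ
    M≢0 M≡0 = ℕ.≢-nonZero⁻¹ _ {{ℕₚ.m^n≢0 m (suc k C 2)}} (+-injective M≡0)

    difference≡0 : difference ≡ 0ℤ
    difference≡0 = [ id , (λ M≡0 → ⊥-elim (M≢0 M≡0)) ]′ (i*j≡0⇒i≡0∨j≡0 difference difference*M≡0)

  σ^-∼⇒count≡ : ∀ k u v → length u ≡ length v → σ^ m (suc k) u ∼[ suc (suc k) ] σ^ m (suc k) v →
                ∀ c → count c u ≡ count c v
  σ^-∼⇒count≡ k u v |u|≡|v| σᵏu∼σᵏv c = begin
    count c u                             ≡⟨ count-map (shift-injective t) c u ⟨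
    count (shift t c) (map (shift t) u)   ≡⟨ cong (λ a → count a (map (shift t) u)) (shift-complement c) ⟩
    count (letter m 0) (map (shift t) u)  ≡⟨ σ^-∼⇒count-zero≡ k (map (shift t) u) (map (shift t) v) |tu|≡|tv| shifted-∼ ⟩
    count (letter m 0) (map (shift t) v)  ≡⟨ cong (λ a → count a (map (shift t) v)) (shift-complement c) ⟨
    count (shift t c) (map (shift t) v)   ≡⟨ count-map (shift-injective t) c v ⟩
    count c v                             ∎
    where
    t = m ∸ toℕ c

    |tu|≡|tv| : length (map (shift t) u) ≡ length (map (shift t) v)
    |tu|≡|tv| = trans (length-map (shift t) u) (trans |u|≡|v| (sym (length-map (shift t) v)))

    shifted-∼ : σ^ m (suc k) (map (shift t) u) ∼[ suc (suc k) ] σ^ m (suc k) (map (shift t) v)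
    shifted-∼ = subst₂ (λ a b → a ∼[ suc (suc k) ] b) (σ^-shift t (suc k) u) (σ^-shift t (suc k) v)
                       (∼-map (shift-injective t) (shift-inverseʳ t) σᵏu∼σᵏv)

-- The identity holds for every m ≥ 1.
corollary4p2 : (m k : ℕ) → .{{_ : NonZero m}} → 2 ≤ m → 1 ≤ k →
    (u v : List (Fin m)) → length u ≡ length v →
    ((+ binom (σ^ m k u) (patternWord m k)) - (+ binom (σ^ m k v) (patternWord m k))
        ≡ ((+ count (letter m 0) u) - (+ count (letter m 0) v)) * (+ (m ^ (k C 2))))
    × (¬ (u ∼[ 1 ] v) → ¬ (σ^ m k u ∼[ suc k ] σ^ m k v))
corollary4p2 m (suc k) _ (s≤s z≤n) u v |u|≡|v| =
  binom-patternWord-difference k u v |u|≡|v| ,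
  λ u≁v σᵏu∼σᵏv → u≁v (count⇒∼₁ (σ^-∼⇒count≡ k u v |u|≡|v| σᵏu∼σᵏv))
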